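{- Let $G=(V,A)$ be a flow graph with start vertex $s$, and let $T$ be a rooted tree with the parent property. Let $u,v$ be vertices such that $v\neq s$ and $u$ is not a descendant of $t(v)$ in $T$. Then every path in $G$ from $u$ to $v$ contains $t(v)$.
   Context: A flow graph is a finite directed graph $G=(V,A)$ with start vertex $s$ such that every vertex is reachable from $s$; there are no arcs entering $s$. For a rooted tree $T$ with vertex set contained in $V$, $t(v)$ denotes the parent of $v$; ancestors and descendants include the vertex itself. $T$ has the parent property if for every arc $(v,w)\in A$, $t(w)$ is an ancestor of $v$ in $T$ (this forces $T$ to be rooted at $s$ with vertex set $V$). -}

module Defs where

open import Data.Nat using (ℕ; zero; suc)
open import Data.Fin using (Fin)
open import Data.Product using (_×_; _,_; ∃-syntax)
open import Data.List using (List; []; _∷_)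
open import Data.List.Membership.Propositional using (_∈_)
open import Relation.Binary.PropositionalEquality using (_≡_)
open import Relation.Nullary using (¬_)

Arcs : ℕ → Set
Arcs n = List (Fin n × Fin n)

-- A path given by its vertex sequence: Path A x y vs means vs = x … y
-- is a walk following arcs of A (vertices may repeat; this only makes
-- "every path contains z" stronger).
data Path {n : ℕ} (A : Arcs n) : Fin n → Fin n → List (Fin n) → Set where
  here : ∀ x → Path A x x (x ∷ [])
  step : ∀ {x y z vs} → (x , y) ∈ A → Path A y z vs → Path A x z (x ∷ vs)

record FlowGraph {n : ℕ} (A : Arcs n) (s : Fin n) : Set where
  field
    reachable : ∀ v → ∃[ vs ] Path A s v vs
    no-entry  : ∀ v → ¬ ((v , s) ∈ A)

iter : {n : ℕ} → (Fin n → Fin n) → ℕ → Fin n → Fin n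
iter t zero    v = v
iter t (suc k) v = t (iter t k v)

Ancestor : {n : ℕ} → (Fin n → Fin n) → Fin n → Fin n → Set
Ancestor t a v = ∃[ k ] iter t k v ≡ a

-- A rooted tree on vertex set Fin n with root s, given by a parent
-- function t (t s = s is a dummy convention for the root): every vertex
-- reaches the root by following parents (hence no cycles except at s).
record RootedTree {n : ℕ} (s : Fin n) (t : Fin n → Fin n) : Set where
  field
    root-fix  : t s ≡ s
    to-root   : ∀ v → Ancestor t s v

ParentProperty : {n : ℕ} → Arcs n → (Fin n → Fin n) → Set
ParentProperty A t = ∀ {v w} → (v , w) ∈ A → Ancestor t (t w) v

module Submission where

-- Fix a vertex a and walk backwards along a path  x = x₀ … x_k = y.
-- The parent property says that for an arc (x , y') the parent t y' is an
-- ancestor of x; hence "a is an ancestor of the parent of the current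
-- vertex" propagates backwards from y' to x unless a is y' itself, in
-- which case a lies on the path.  So for every path from x to y and every
-- ancestor a of t y, either a occurs on the path or a is an ancestor of x
-- (`parent-ancestor-on-path-or-above`).
--
-- The theorem is the instance a = t v, x = u: since t v is not an
-- ancestor of u by hypothesis, t v must occur on the path.

open import Defs
open import Data.Nat using (ℕ; zero; suc; _+_)
open import Data.Fin using (Fin)
open import Data.List using (List; _∷_)
open import Data.List.Membership.Propositional using (_∈_)
open import Data.List.Relation.Unary.Any using (here; there)
open import Data.Product using (_,_)
open import Data.Sum using (_⊎_; inj₁; inj₂; [_,_])
open import Relation.Binary.PropositionalEquality
  using (_≡_; refl; sym; trans; cong; subst)
open import Data.Empty using (⊥-elim)
open import Function using (_∘_)
open import Relation.Nullary using (¬_)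

module _ {n : ℕ} (t : Fin n → Fin n) where

  iter-suc : ∀ k y → iter t (suc k) y ≡ iter t k (t y)
  iter-suc zero    y = refl
  iter-suc (suc k) y = cong t (iter-suc k y)

  iter-+ : ∀ j m x → iter t j (iter t m x) ≡ iter t (j + m) x
  iter-+ zero    m x = refl
  iter-+ (suc j) m x = cong t (iter-+ j m x)

  ancestor-trans : ∀ {a b c} → Ancestor t a b → Ancestor t b c → Ancestor t a c
  ancestor-trans {c = c} (j , b↑a) (m , c↑b) =
    j + m , trans (sym (iter-+ j m c)) (trans (cong (iter t j) c↑b) b↑a)

  ancestor-of-parent : ∀ {a y} → Ancestor t a (t y) → Ancestor t a y
  ancestor-of-parent a↑ty = ancestor-trans a↑ty (1 , refl)

  ancestor-cases : ∀ {a y} → Ancestor t a y → a ≡ y ⊎ Ancestor t a (t y)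
  ancestor-cases (zero  , y≡a)   = inj₁ (sym y≡a)
  ancestor-cases {y = y} (suc k , y↑a) = inj₂ (k , trans (sym (iter-suc k y)) y↑a)

head∈path : ∀ {n} {A : Arcs n} {x y vs} → Path A x y vs → x ∈ vs
head∈path (here _)   = here refl
head∈path (step _ _) = here refl

parent-ancestor-on-path-or-above :
  ∀ {n} {A : Arcs n} {t : Fin n → Fin n} → ParentProperty A t
  → ∀ {a x y vs} → Path A x y vs → Ancestor t a (t y) → a ∈ vs ⊎ Ancestor t a x
parent-ancestor-on-path-or-above {t = t} pp (here _) a↑ty =
  inj₂ (ancestor-of-parent t a↑ty)
parent-ancestor-on-path-or-above {t = t} pp (step x→y' p) a↑ty
  with parent-ancestor-on-path-or-above pp p a↑ty
... | inj₁ a∈tail = inj₁ (there a∈tail)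
... | inj₂ a↑y' =
  [ (λ a≡y' → inj₁ (there (subst (_∈ _) (sym a≡y') (head∈path p))))
  , (λ a↑ty' → inj₂ (ancestor-trans t a↑ty' (pp x→y')))
  ] (ancestor-cases t a↑y')

lemma2 : {n : ℕ} (A : Arcs n) (s : Fin n) (t : Fin n → Fin n)
    → FlowGraph A s → RootedTree s t → ParentProperty A t
    → (u v : Fin n) → ¬ (v ≡ s) → ¬ Ancestor t (t v) u
    → (vs : List (Fin n)) → Path A u v vs → t v ∈ vs
lemma2 A s t _ _ pp u v _ tv∤u vs p =
  [ (λ tv∈vs → tv∈vs) , (⊥-elim ∘ tv∤u) ]
  (parent-ancestor-on-path-or-above pp p (0 , refl))
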